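{- Let $\mathcal{A}$ be a deterministic write-once Turing machine with $s$ states and space complexity $f(n)=\exp_k(n^t)$. If $\mathcal{A}$ is started (on an input of length $n$) in a configuration from which it eventually halts, then it makes at most $O(f(n)\cdot s)$ steps between any two consecutive writes.
   Context: $\exp_0(x)=x$, $\exp_{j+1}(x)=2^{\exp_j(x)}$. A write-once Turing machine is a Turing machine with a single tape, infinite in one direction, a single read/write head, and tape alphabet $\{0,1\}$ (0 = blank, 1 = marked), which may never write a blank onto a marked cell (re-marking a marked cell is allowed). Space complexity $f(n)$ means that on inputs of length $n$ at most $f(n)$ tape cells are used. -}

module Defs where

open import Data.Nat using (ℕ; zero; suc; _+_; _*_; _∸_; _^_; _≤_; _<_)
open import Data.Bool using (Bool; true; false)
open import Data.Fin using (Fin)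
open import Data.List using (List; []; _∷_; length)
open import Data.Maybe using (Maybe; just; nothing)
open import Data.Product using (Σ; ∃; ∃-syntax; _×_; _,_)
open import Relation.Binary.PropositionalEquality using (_≡_)
open import Relation.Nullary using (¬_; yes; no)
open import Data.Nat using (_≟_)

exp : ℕ → ℕ → ℕ
exp zero    x = x
exp (suc j) x = 2 ^ exp j x

data Move : Set where
  L R : Move

-- Deterministic write-once Turing machine with s states, tape alphabet
-- {0,1} encoded as Bool (false = 0 = blank, true = 1 = marked).
-- δ q b = nothing means the machine halts in state q reading b.
record WOTM (s : ℕ) : Set where
  field
    δ         : Fin s → Bool → Maybe (Fin s × Bool × Move)
    q₀        : Fin s
    writeOnce : ∀ q q' b m → δ q true ≡ just (q' , b , m) → b ≡ true

record Config (s : ℕ) : Set where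
  constructor conf
  field
    state : Fin s
    head  : ℕ
    tape  : ℕ → Bool
open Config public

module _ {s : ℕ} (M : WOTM s) where
  open WOTM M

  move : Move → ℕ → ℕ
  move L zero    = zero
  move L (suc p) = p
  move R p       = suc p

  update : (ℕ → Bool) → ℕ → Bool → ℕ → Bool
  update t p b i with i ≟ p
  ... | yes _ = b
  ... | no  _ = t i

  step : Config s → Maybe (Config s)
  step (conf q p t) with δ q (t p)
  ... | nothing             = nothing
  ... | just (q' , b , m)   = just (conf q' (move m p) (update t p b))

  run : ℕ → Config s → Maybe (Config s)
  run zero    c = just c
  run (suc i) c with run i c
  ... | nothing = nothing
  ... | just a  = step a

  initTape : List Bool → ℕ → Bool
  initTape []       _       = false
  initTape (x ∷ w)  zero    = x
  initTape (x ∷ w)  (suc i) = initTape w i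

  init : List Bool → Config s
  init w = conf q₀ zero (initTape w)

  Reachable : Config s → Config s → Set
  Reachable c₀ c = ∃[ r ] run r c₀ ≡ just c

  Halts : Config s → Set
  Halts c = ∃[ m ] Σ (Config s) λ h → (run m c ≡ just h) × (step h ≡ nothing)

  -- space complexity f: on every input of length n the head only visits
  -- cells 0 .. f(n)-1 (the visited cells form an initial segment, so this is
  -- "at most f(n) tape cells are used")
  HasSpace : (ℕ → ℕ) → Set
  HasSpace f = ∀ (w : List Bool) (i : ℕ) (c : Config s) →
               run i (init w) ≡ just c → head c < f (length w)

  IsWrite : Config s → Set
  IsWrite a = (tape a (head a) ≡ false) ×
              (∃[ q ] ∃[ m ] δ (state a) (tape a (head a)) ≡ just (q , true , m))

  -- the (i+1)-st step of the run started in c is a write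
  WriteAt : Config s → ℕ → Set
  WriteAt c i = Σ (Config s) λ a → (run i c ≡ just a) × IsWrite a

-- Between two consecutive writes the tape does not change, so the machine's
-- configuration is determined by its state and head position, of which there
-- are at most f(n)·s. If the gap between the writes were longer, two of the
-- configurations in it would coincide; a deterministic machine then repeats
-- that stretch forever and never halts. Hence C = 1 works.
module Submission where

open import Defs
open import Data.Nat using (ℕ; zero; suc; s≤s; _+_; _*_; _∸_; _^_; _≤_; _<_; _≟_; _<?_; >-nonZero)
open import Data.Nat.Properties
open import Data.Bool using (Bool; true; false)
open import Data.Bool.Properties using (¬-not)
open import Data.Fin using (Fin; toℕ; fromℕ<; combine)
import Data.Fin.Properties as Fin
open import Data.List using (List; length)
open import Data.Maybe using (just; nothing; _>>=_)
open import Data.Maybe.Relation.Binary.Pointwise using (Pointwise; just; nothing; just-inv)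
open import Data.Product using (∃-syntax; ∃₂; _×_; _,_; proj₁; proj₂)
open import Relation.Binary.PropositionalEquality
open import Relation.Nullary using (¬_; yes; no; contradiction)

module _ {s : ℕ} (M : WOTM s) where
  open WOTM M

  run-suc : ∀ n c → run M (suc n) c ≡ (run M n c >>= step M)
  run-suc n c with run M n c
  ... | nothing = refl
  ... | just _  = refl

  run-+ : ∀ l r {c b} → run M r c ≡ just b → run M (l + r) c ≡ run M l b
  run-+ zero    r eq = eq
  run-+ (suc l) r {c} {b} eq = begin
    run M (suc l + r) c           ≡⟨ run-suc (l + r) c ⟩
    (run M (l + r) c >>= step M)  ≡⟨ cong (_>>= step M) (run-+ l r eq) ⟩
    (run M l b >>= step M)        ≡⟨ run-suc l b ⟨
    run M (suc l) b               ∎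
    where open ≡-Reasoning

  run-+-nothing : ∀ l r {c} → run M r c ≡ nothing → run M (l + r) c ≡ nothing
  run-+-nothing zero    r eq = eq
  run-+-nothing (suc l) r {c} eq =
    trans (run-suc (l + r) c) (cong (_>>= step M) (run-+-nothing l r eq))

  run-defined-≤ : ∀ {l n c b} → l ≤ n → run M n c ≡ just b → ∃[ a ] run M l c ≡ just a
  run-defined-≤ {l} {n} {c} l≤n eq with run M l c in eqₗ
  ... | just a  = a , refl
  ... | nothing = contradiction (trans (sym eq) n-halted) λ ()
    where
    n-halted : run M n c ≡ nothing
    n-halted = subst (λ m → run M m c ≡ nothing) (m∸n+n≡m l≤n) (run-+-nothing (n ∸ l) l eqₗ)

  Terminates : Config s → Set
  Terminates c = ∃[ m ] run M m c ≡ nothing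

  halts⇒terminates : ∀ {c} → Halts M c → Terminates c
  halts⇒terminates {c} (m , h , eq , halted) =
    suc m , trans (run-suc m c) (trans (cong (_>>= step M) eq) halted)

  terminates-shift : ∀ r {c b} → run M r c ≡ just b → Terminates c → Terminates b
  terminates-shift r {c} eq (m , halted) =
    m , trans (sym (run-+ m r eq))
              (subst (λ k → run M k c ≡ nothing) (+-comm r m) (run-+-nothing r m halted))

  HeadsBelow : ℕ → Config s → Set
  HeadsBelow F c = ∀ l a → run M l c ≡ just a → head a < F

  headsBelow-shift : ∀ {F} r {c b} → run M r c ≡ just b → HeadsBelow F c → HeadsBelow F b
  headsBelow-shift r eq bound l a eqₗ = bound (l + r) a (trans (run-+ l r eq) eqₗ)

  writeAt-shift : ∀ r {c b l} → run M r c ≡ just b → WriteAt M b l → WriteAt M c (l + r)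
  writeAt-shift r {l = l} eq (a , eqₗ , write) = a , trans (run-+ l r eq) eqₗ , write

  -- Tapes are functions, so configurations are compared extensionally.
  _≈_ : Config s → Config s → Set
  a ≈ b = state a ≡ state b × head a ≡ head b × tape a ≗ tape b

  ≈-refl : ∀ {a} → a ≈ a
  ≈-refl = refl , refl , λ _ → refl

  ≈-sym : ∀ {a b} → a ≈ b → b ≈ a
  ≈-sym (q≡ , h≡ , t≗) = sym q≡ , sym h≡ , λ p → sym (t≗ p)

  ≈-trans : ∀ {a b c} → a ≈ b → b ≈ c → a ≈ c
  ≈-trans (q≡ , h≡ , t≗) (q≡′ , h≡′ , t≗′) = trans q≡ q≡′ , trans h≡ h≡′ , λ p → trans (t≗ p) (t≗′ p)

  update-cong : ∀ {t t′} p b → t ≗ t′ → update M t p b ≗ update M t′ p b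
  update-cong p b t≗t′ i with i ≟ p
  ... | yes _ = refl
  ... | no  _ = t≗t′ i

  step-≈ : ∀ {a b} → a ≈ b → Pointwise _≈_ (step M a) (step M b)
  step-≈ {conf q h t} {conf .q .h t′} (refl , refl , t≗t′) rewrite t≗t′ h with δ q (t′ h)
  ... | nothing            = nothing
  ... | just (q′ , b , m)  = just (refl , refl , update-cong h b t≗t′)

  run-≈ : ∀ n {a b} → a ≈ b → Pointwise _≈_ (run M n a) (run M n b)
  run-≈ zero    a≈b = just a≈b
  run-≈ (suc n) {a} {b} a≈b
    rewrite run-suc n a | run-suc n b with run M n a | run M n b | run-≈ n a≈b
  ... | _ | _ | nothing = nothing
  ... | _ | _ | just r  = step-≈ r

  run-periodic : ∀ {p a a′} → run M p a ≡ just a′ → a′ ≈ a →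
                 ∀ d → ∃[ b ] run M (d * p) a ≡ just b × b ≈ a
  run-periodic {a = a} eq a′≈a zero = a , refl , ≈-refl
  run-periodic {p} {a} eq a′≈a (suc d) with run-periodic eq a′≈a d
  ... | b , eqᵈ , b≈a
    with just-inv (subst (λ r → Pointwise _≈_ r (run M p b)) eq (run-≈ p (≈-sym b≈a)))
  ...   | b′ , eq′ , a′≈b′ = b′ , trans (run-+ p (d * p) eqᵈ) eq′ , ≈-trans (≈-sym a′≈b′) a′≈a

  recurrence⇒¬terminates : ∀ {x y c a₁ a₂} → x < y → run M x c ≡ just a₁ →
                           run M y c ≡ just a₂ → a₁ ≈ a₂ → ¬ Terminates c
  recurrence⇒¬terminates {x} {y} {c} {a₁} {a₂} x<y eq₁ eq₂ a₁≈a₂ stops =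
    a₁-diverges (terminates-shift x eq₁ stops)
    where
    p = y ∸ x
    instance _ = >-nonZero (m<n⇒0<n∸m x<y)
    period : run M p a₁ ≡ just a₂
    period = trans (sym (run-+ p x eq₁))
                   (subst (λ k → run M k c ≡ just a₂) (sym (m∸n+n≡m (<⇒≤ x<y))) eq₂)
    a₁-diverges : ¬ Terminates a₁
    a₁-diverges (m , halted)
      with b , eqᵐᵖ , _ ← run-periodic period (≈-sym a₁≈a₂) m
      with a , eqᵐ ← run-defined-≤ (m≤m*n m p) eqᵐᵖ
      = contradiction (trans (sym halted) eqᵐ) λ ()

  update-same : ∀ t p {b} → t p ≡ b → update M t p b ≗ t
  update-same t p t[p]≡b i with i ≟ p
  ... | yes refl = sym t[p]≡b
  ... | no  _    = refl

  nonwrite-keeps-scanned : ∀ {a q b m} → ¬ IsWrite M a →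
                           δ (state a) (tape a (head a)) ≡ just (q , b , m) → tape a (head a) ≡ b
  nonwrite-keeps-scanned {b = true} ¬write eq = ¬-not λ blank → ¬write (blank , _ , _ , eq)
  nonwrite-keeps-scanned {a} {b = false} ¬write eq = ¬-not λ marked →
    contradiction (writeOnce _ _ _ _ (subst (λ x → δ (state a) x ≡ _) marked eq)) λ ()

  step-inv : ∀ {q h t a′} → step M (conf q h t) ≡ just a′ →
             ∃[ q′ ] ∃[ b ] ∃[ m ] δ q (t h) ≡ just (q′ , b , m) × a′ ≡ conf q′ (move M m h) (update M t h b)
  step-inv {q} {h} {t} eq with δ q (t h)
  step-inv refl | just (q′ , b , m) = q′ , b , m , refl , refl

  nonwrite-step-tape : ∀ {a a′} → ¬ IsWrite M a → step M a ≡ just a′ → tape a′ ≗ tape a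
  nonwrite-step-tape {conf q h t} ¬write eq with step-inv eq
  ... | _ , _ , _ , eqδ , refl = update-same t h (nonwrite-keeps-scanned {conf q h t} ¬write eqδ)

  tape-frozen : ∀ {c} n {a} → (∀ l → l < n → ¬ WriteAt M c l) → run M n c ≡ just a → tape a ≗ tape c
  tape-frozen zero noWrite refl _ = refl
  tape-frozen {c} (suc n) noWrite eq with run M n c in eqₙ
  ... | just a′ = λ p →
    trans (nonwrite-step-tape (λ write → noWrite n (n<1+n n) (a′ , eqₙ , write)) eq p)
          (tape-frozen n (λ l l<n → noWrite l (m<n⇒m<1+n l<n)) eqₙ p)

  write-free-run-bound : ∀ {F c d e} → HeadsBelow F c → Terminates c → run M d c ≡ just e →
                         (∀ l → l < d → ¬ WriteAt M c l) → d < F * s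
  write-free-run-bound {F} {c} {d} bound stops eqᵈ noWrite with d <? F * s
  ... | yes d<Fs = d<Fs
  ... | no  d≮Fs = contradiction stops (collision (Fin.pigeonhole (s≤s (≮⇒≥ d≮Fs)) label))
    where
    at : (x : Fin (suc d)) → ∃[ a ] run M (toℕ x) c ≡ just a
    at x = run-defined-≤ (Fin.toℕ≤pred[n] x) eqᵈ

    configAt : Fin (suc d) → Config s
    configAt x = proj₁ (at x)

    headAt : (x : Fin (suc d)) → head (configAt x) < F
    headAt x = bound (toℕ x) (configAt x) (proj₂ (at x))

    label : Fin (suc d) → Fin (F * s)
    label x = combine (fromℕ< (headAt x)) (state (configAt x))

    tapeAt : (x : Fin (suc d)) → tape (configAt x) ≗ tape c
    tapeAt x = tape-frozen (toℕ x) (λ l l<x → noWrite l (<-≤-trans l<x (Fin.toℕ≤pred[n] x)))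
                           (proj₂ (at x))

    collision : (∃₂ λ x y → toℕ x < toℕ y × label x ≡ label y) → ¬ Terminates c
    collision (x , y , x<y , same) =
      recurrence⇒¬terminates x<y (proj₂ (at x)) (proj₂ (at y)) (state≡ , head≡ , tape≗)
      where
      state≡ : state (configAt x) ≡ state (configAt y)
      state≡ = Fin.combine-injectiveʳ (fromℕ< (headAt x)) _ (fromℕ< (headAt y)) _ same
      head≡ : head (configAt x) ≡ head (configAt y)
      head≡ = begin
        head (configAt x)          ≡⟨ Fin.toℕ-fromℕ< (headAt x) ⟨
        toℕ (fromℕ< (headAt x))    ≡⟨ cong toℕ (Fin.combine-injectiveˡ (fromℕ< (headAt x)) _
                                                                        (fromℕ< (headAt y)) _ same) ⟩
        toℕ (fromℕ< (headAt y))    ≡⟨ Fin.toℕ-fromℕ< (headAt y) ⟩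
        head (configAt y)          ∎
        where open ≡-Reasoning
      tape≗ : tape (configAt x) ≗ tape (configAt y)
      tape≗ p = trans (tapeAt x p) (sym (tapeAt y p))

  consecutive-writes-gap : ∀ {F c i j} → HeadsBelow F c → Terminates c → i < j → WriteAt M c j →
                           (∀ l → i < l → l < j → ¬ WriteAt M c l) → j ∸ i ≤ F * s
  consecutive-writes-gap {F} {c} {i} {j} bound stops i<j (aⱼ , eqⱼ , _) noWrite =
    gap-from (proj₂ (run-defined-≤ i<j eqⱼ))
    where
    d = j ∸ suc i

    d+[1+i]≡j : d + suc i ≡ j
    d+[1+i]≡j = m∸n+n≡m i<j

    gap-from : ∀ {b} → run M (suc i) c ≡ just b → j ∸ i ≤ F * s
    gap-from {b} eqᵇ =
      -- suc j ∸ suc i reduces to j ∸ i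
      subst (_≤ F * s) (sym (+-∸-assoc 1 i<j))
        (write-free-run-bound (headsBelow-shift (suc i) eqᵇ bound)
                              (terminates-shift (suc i) eqᵇ stops) eqᵈ noWrite-from-b)
      where
      eqᵈ : run M d b ≡ just aⱼ
      eqᵈ = trans (sym (run-+ d (suc i) eqᵇ)) (subst (λ k → run M k c ≡ just aⱼ) (sym d+[1+i]≡j) eqⱼ)

      noWrite-from-b : ∀ l → l < d → ¬ WriteAt M b l
      noWrite-from-b l l<d write =
        noWrite (l + suc i) (m≤n+m (suc i) l) (<-≤-trans (+-monoˡ-< (suc i) l<d) (≤-reflexive d+[1+i]≡j))
                (writeAt-shift (suc i) {l = l} eqᵇ write)

  space⇒headsBelow : ∀ {f w c} → HasSpace M f → Reachable M (init M w) c →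
                     HeadsBelow (f (length w)) c
  space⇒headsBelow {w = w} space (r , reached) l a eq =
    space w (l + r) a (trans (run-+ l r reached) eq)

lemma1 : ∃[ C ] ∀ (k t s : ℕ) (M : WOTM s) →
           HasSpace M (λ n → exp k (n ^ t)) →
           ∀ (n : ℕ) (w : List Bool) → length w ≡ n →
           ∀ (c : Config s) → Reachable M (init M w) c → Halts M c →
           ∀ (i j : ℕ) → i < j → WriteAt M c i → WriteAt M c j →
           (∀ l → i < l → l < j → ¬ WriteAt M c l) →
           j ∸ i ≤ C * (exp k (n ^ t) * s)
lemma1 = 1 , λ where
  k t s M space .(length w) w refl c reached halts i j i<j _ writeⱼ noWrite →
    subst (j ∸ i ≤_) (sym (*-identityˡ _))
      (consecutive-writes-gap M (space⇒headsBelow M {λ n → exp k (n ^ t)} {w} space reached)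
                                (halts⇒terminates M halts) i<j writeⱼ noWrite)
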